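{- The downward closure $\mathcal{W}$ of the widdershins spirals is well-quasi-ordered under the permutation containment order; that is, it contains no infinite antichain.
   Context: Permutations are identified with their plots $\{(i,\pi(i))\}$, and more generally with finite generic point sets in the plane (no two points share an $x$- or $y$-coordinate), up to order-isomorphism. A permutation $\sigma$ is contained in $\pi$ if some subset of the plot of $\pi$ is order-isomorphic to the plot of $\sigma$. The rectangular hull of a finite point set is the smallest axis-parallel rectangle containing it. Given points $p_1,\dots,p_i$, a proper pin for $(p_1,\dots,p_i)$ is a point $p$ lying outside the rectangular hull $R$ of $\{p_1,\dots,p_i\}$ that lies horizontally or vertically between $p_i$ and the rectangular hull of $\{p_1,\dots,p_{i-1}\}$; it is a left, right, up, or down pin according as it lies to the left of, right of, above, or below $R$. A widdershins spiral of standard orientation is (the permutation of) a generic point sequence $p_1,\dots,p_k$, $k\ge 4$, with $p_2$ above and to the left of $p_1$, each $p_{i+1}$ ($i\ge2$) a proper pin for $(p_1,\dots,p_i)$, and the directions of $p_3,p_4,\dots$ forming an initial segment of left, down, right, up, left, down, right, up, $\dots$. A widdershins spiral is such a permutation or its rotation by $90^\circ$, $180^\circ$ or $270^\circ$. $\mathcal{W}$ is the set of all permutations contained in some widdershins spiral. -}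

module Defs where

open import Data.Nat as ℕ using (ℕ; zero; suc; _∸_; _%_)
open import Data.Integer as ℤ using (ℤ; -_)
open import Data.Fin as Fin using (Fin)
open import Data.Product using (Σ; ∃; _×_; _,_; proj₁; proj₂)
open import Data.Sum using (_⊎_)
open import Function.Bundles using (_⇔_)
open import Function.Definitions using (Injective)
open import Relation.Binary.PropositionalEquality using (_≡_; _≢_)
open import Relation.Nullary using (¬_)

-- Permutations of length len: injective maps Fin len → Fin len,
-- identified with their plots {(i, f i)}.

record Perm : Set where
  field
    len : ℕ
    fun : Fin len → Fin len
    inj : Injective _≡_ _≡_ fun
open Perm public

_≼_ : Perm → Perm → Set
σ ≼ π = Σ (Fin (len σ) → Fin (len π)) λ e →
          (∀ i j → i Fin.< j → e i Fin.< e j) ×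
          (∀ i j → (fun σ i Fin.< fun σ j) ⇔ (fun π (e i) Fin.< fun π (e j)))

-- Points in the plane (integer coordinates suffice: finite generic
-- point sets are considered up to order-isomorphism).

Point : Set
Point = ℤ × ℤ

xc : Point → ℤ
xc = proj₁

yc : Point → ℤ
yc = proj₂

rot : Point → Point
rot (a , b) = (- b , a)

rotN : ℕ → Point → Point
rotN zero    p = p
rotN (suc r) p = rot (rotN r p)

-- A point sequence p_0, …, p_{k-1} is given as P : ℕ → Point
-- (only the indices < k matter).  Generic: no two points share an
-- x- or a y-coordinate.
Generic : ℕ → (ℕ → Point) → Set
Generic k P = ∀ i j → i ℕ.< k → j ℕ.< k → i ≢ j →
              (xc (P i) ≢ xc (P j)) × (yc (P i) ≢ yc (P j))

data Dir : Set where
  left down right up : Dir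

SideOfHull : Dir → (ℕ → Point) → ℕ → Point → Set
SideOfHull left  P n p = ∀ j → j ℕ.< n → xc p ℤ.< xc (P j)
SideOfHull right P n p = ∀ j → j ℕ.< n → xc (P j) ℤ.< xc p
SideOfHull down  P n p = ∀ j → j ℕ.< n → yc p ℤ.< yc (P j)
SideOfHull up    P n p = ∀ j → j ℕ.< n → yc (P j) ℤ.< yc p

YBetween : (ℕ → Point) → ℕ → Point → Point → Set
YBetween P m q p =
  ((∀ j → j ℕ.< m → yc (P j) ℤ.< yc p) × (yc p ℤ.< yc q)) ⊎
  ((∀ j → j ℕ.< m → yc p ℤ.< yc (P j)) × (yc q ℤ.< yc p))

XBetween : (ℕ → Point) → ℕ → Point → Point → Set
XBetween P m q p =
  ((∀ j → j ℕ.< m → xc (P j) ℤ.< xc p) × (xc p ℤ.< xc q)) ⊎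
  ((∀ j → j ℕ.< m → xc p ℤ.< xc (P j)) × (xc q ℤ.< xc p))

ProperPin : Dir → (ℕ → Point) → ℕ → Point → Set
ProperPin d P n p =
  SideOfHull d P n p ×
  (YBetween P (n ∸ 1) (P (n ∸ 1)) p ⊎ XBetween P (n ∸ 1) (P (n ∸ 1)) p)

-- direction of the point with 0-based index n ≥ 2 in a standard
-- widdershins spiral: left, down, right, up, left, … starting at n = 2.
dirOf : ℕ → Dir
dirOf n with n % 4
... | 0 = right
... | 1 = up
... | 2 = left
... | _ = down

StdSpiral : ℕ → (ℕ → Point) → Set
StdSpiral k P =
  4 ℕ.≤ k ×
  Generic k P ×
  (xc (P 1) ℤ.< xc (P 0)) × (yc (P 0) ℤ.< yc (P 1)) ×
  (∀ n → 2 ℕ.≤ n → n ℕ.< k → ProperPin (dirOf n) P n (P n))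

WSpiral : ℕ → (ℕ → Point) → Set
WSpiral k P = Σ ℕ λ r → StdSpiral k (λ n → rotN r (P n))

ContainedIn : Perm → ℕ → (ℕ → Point) → Set
ContainedIn σ k P = Σ (Fin (len σ) → ℕ) λ e →
  (∀ i → e i ℕ.< k) ×
  (∀ i j → (i Fin.< j) ⇔ (xc (P (e i)) ℤ.< xc (P (e j)))) ×
  (∀ i j → (fun σ i Fin.< fun σ j) ⇔ (yc (P (e i)) ℤ.< yc (P (e j))))

InW : Perm → Set
InW σ = Σ ℕ λ k → Σ (ℕ → Point) λ P → WSpiral k P × ContainedIn σ k P

InfiniteAntichainInW : Set
InfiniteAntichainInW = Σ (ℕ → Perm) λ s →
  (∀ n → InW (s n)) × (∀ m n → m ≢ n → ¬ (s m ≼ s n))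

module Submission where

-- In a standard widdershins spiral p₀, p₁, … the relative position of
-- two points pₐ, p_b (a < b) is completely determined by b mod 4 (the direction
-- of the pin p_b) and by whether b = a + 1.  Rotating the spiral by r quarter
-- turns only permutes these positions, depending on r mod 4.  Hence a
-- permutation σ ∈ 𝒲 is determined by r mod 4 and the set of spiral indices its
-- points occupy, and it suffices to remember that set as its list of maximal
-- runs of consecutive indices, each run labelled by (start mod 4, length).  If
-- the runs of σ embed into those of σ' (Higman order, runs compared by equal
-- start residue and smaller length), shifting each run into its partner gives
-- an index map preserving order, residues mod 4 and adjacency, so σ ≼ σ'.

open import Defs
open import Data.Bool using (Bool; true; false; not)
open import Data.Bool.Properties using (not-involutive)
open import Data.Empty using (⊥; ⊥-elim)
open import Data.Fin as Fin using (Fin)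
open import Data.Fin.Properties using (any?)
open import Data.Integer as ℤ using (ℤ)
open import Data.Integer.Properties as ℤP using ()
open import Data.List using (List; []; _∷_; length; _++_)
open import Data.List.Relation.Unary.All using (All; []; _∷_)
open import Data.List.Relation.Unary.Any using (Any; here; there)
open import Data.List.Relation.Binary.Sublist.Heterogeneous using (Sublist; []; _∷_; _∷ʳ_; minimum)
open import Data.List.Relation.Binary.Sublist.Heterogeneous.Properties using (sublist?; ++⁺)
open import Data.Nat as ℕ using (ℕ; zero; suc; z≤n; s≤s; _+_; _*_; _∸_; _%_; _/_; _≤?_; _≟_)
open import Data.Nat.DivMod using (m≡m%n+[m/n]*n; %-distribˡ-+; m%n≤n)
open import Data.Nat.Properties as ℕP using ()
open import Data.Product using (Σ; ∃; _×_; _,_; proj₁; proj₂)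
open import Data.Sum using (_⊎_; inj₁; inj₂; swap)
open import Data.Sum.Relation.Binary.Pointwise using (Pointwise; inj₁; inj₂)
open import Data.Unit using (⊤; tt)
open import Function using (_∘_; _on_)
open import Function.Bundles using (_⇔_; mk⇔; Equivalence)
open import Function.Construct.Composition using (_⇔-∘_)
open import Function.Construct.Symmetry using (⇔-sym)
open import Level using (0ℓ)
open import Relation.Binary using (Rel; _⇒_; Decidable; tri<; tri≈; tri>)
open import Relation.Binary.Construct.Intersection using (_∩_)
open import Relation.Binary.PropositionalEquality using (_≡_; _≢_; refl; sym; trans; cong; cong₂; subst; subst₂; module ≡-Reasoning)
open import Relation.Nullary using (¬_; Dec; does; yes; no; _⊎-dec_; _×-dec_)
open import Relation.Nullary.Decidable using (does-⇔)

open Equivalence using (to; from)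

Full : {X : Set} → Rel X 0ℓ → Set
Full R = ∀ x y → R x y

-- R ↑ x also relates y to everything as soon as x R y; an AF relation is one
-- that becomes full after finitely many such enlargements, whichever
-- elements are chosen (a constructive rendering of "every sequence is good").
_↑_ : {X : Set} → Rel X 0ℓ → X → Rel X 0ℓ
(R ↑ x) y z = R y z ⊎ R x y

data AF {X : Set} : Rel X 0ℓ → Set₁ where
  now   : {R : Rel X 0ℓ} → Full R → AF R
  later : {R : Rel X 0ℓ} → (∀ x → AF (R ↑ x)) → AF R

AF-mono : {X : Set} {R S : Rel X 0ℓ} → AF R → R ⇒ S → AF S
AF-mono (now f) R⇒S = now (λ x y → R⇒S (f x y))
AF-mono (later h) R⇒S = later λ x → AF-mono (h x) λ
  { (inj₁ r) → inj₁ (R⇒S r) ; (inj₂ r) → inj₂ (R⇒S r) }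

AF-comap : {X Y : Set} {R : Rel X 0ℓ} (f : Y → X) → AF R → AF (R on f)
AF-comap f (now g) = now (λ a b → g (f a) (f b))
AF-comap f (later h) = later (λ a → AF-comap f (h (f a)))

AF-good : {X : Set} {R : Rel X 0ℓ} → AF R → (f : ℕ → X) →
          Σ ℕ λ i → Σ ℕ λ j → i ℕ.< j × R (f i) (f j)
AF-good (now g) f = 0 , 1 , s≤s z≤n , g _ _
AF-good (later h) f with AF-good (h (f 0)) (f ∘ suc)
... | i , j , i<j , inj₁ r = suc i , suc j , s≤s i<j , r
... | i , j , i<j , inj₂ r = 0 , suc i , s≤s z≤n , r

-- Below every bound m the order ≤ is AF; induction on m, since after
-- seeing k < m the elements ≥ k are already taken care of.
af-≤-or-above : ∀ m → AF (λ y z → y ℕ.≤ z ⊎ m ℕ.≤ y)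
af-≤-or-above zero = now (λ _ _ → inj₂ z≤n)
af-≤-or-above (suc m) = later step
  where
  step : ∀ k → AF ((λ y z → y ℕ.≤ z ⊎ suc m ℕ.≤ y) ↑ k)
  step k with suc m ≤? k
  ... | yes m<k = now (λ _ _ → inj₂ (inj₂ m<k))
  ... | no m≮k = AF-mono (af-≤-or-above m) λ
    { (inj₁ y≤z) → inj₁ (inj₁ y≤z)
    ; (inj₂ m≤y) → inj₂ (inj₁ (ℕP.≤-trans (ℕP.≮⇒≥ m≮k) m≤y)) }

AF-≤ : AF ℕ._≤_
AF-≤ = later af-≤-or-above

LeftMinimal : {A B : Set} → Rel B 0ℓ → Rel (A ⊎ B) 0ℓ
LeftMinimal RB (inj₁ _) _        = ⊤
LeftMinimal RB (inj₂ _) (inj₁ _) = ⊥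
LeftMinimal RB (inj₂ b) (inj₂ c) = RB b c

RightMinimal : {A B : Set} → Rel A 0ℓ → Rel (A ⊎ B) 0ℓ
RightMinimal RA = LeftMinimal RA on swap

-- LeftMinimal and RightMinimal of AF relations are AF: a left element is
-- below all later ones, so only right elements need to be considered.
af-leftMinimal : {A B : Set} {RB : Rel B 0ℓ} → AF RB → AF (LeftMinimal {A} RB)
af-leftMinimal {A} {B} aB = later λ
  { (inj₁ _) → now (λ _ _ → inj₂ tt)
  ; (inj₂ b) → below aB b }
  where
  below : {S : Rel B 0ℓ} → AF S → ∀ b → AF (LeftMinimal {A} S ↑ inj₂ b)
  below (now f) b = now λ { (inj₁ _) _ → inj₁ tt ; (inj₂ c) _ → inj₂ (f b c) }
  below (later h) b = AF-mono (af-leftMinimal (h b)) λ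
    { {inj₁ _} _ → inj₁ tt
    ; {inj₂ _} {inj₂ _} (inj₁ r) → inj₁ r
    ; {inj₂ _} {inj₂ _} (inj₂ r) → inj₂ r }

af-rightMinimal : {A B : Set} {RA : Rel A 0ℓ} → AF RA → AF (RightMinimal {A} {B} RA)
af-rightMinimal aA = AF-comap swap (af-leftMinimal aA)

module _ {A B : Set} {RA : Rel A 0ℓ} {RB : Rel B 0ℓ} where

  pointwise-↑₁ : ∀ a → Pointwise (RA ↑ a) RB ⇒ (Pointwise RA RB ↑ inj₁ a)
  pointwise-↑₁ a (inj₁ (inj₁ r)) = inj₁ (inj₁ r)
  pointwise-↑₁ a (inj₁ (inj₂ r)) = inj₂ (inj₁ r)
  pointwise-↑₁ a (inj₂ r)        = inj₁ (inj₂ r)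

  pointwise-↑₂ : ∀ b → Pointwise RA (RB ↑ b) ⇒ (Pointwise RA RB ↑ inj₂ b)
  pointwise-↑₂ b (inj₁ r)        = inj₁ (inj₁ r)
  pointwise-↑₂ b (inj₂ (inj₁ r)) = inj₁ (inj₂ r)
  pointwise-↑₂ b (inj₂ (inj₂ r)) = inj₂ (inj₂ r)

  pointwise-swap : (Pointwise RB RA on swap) ⇒ Pointwise RA RB
  pointwise-swap {inj₁ _} {inj₁ _} (inj₂ r) = inj₁ r
  pointwise-swap {inj₂ _} {inj₂ _} (inj₁ r) = inj₂ r

-- The sum of a full relation and an AF relation is AF: once a left element
-- has been seen, every later left element is good, so only the right part
-- still has to become full.
af-sum-fullLeft : {A B : Set} {RA : Rel A 0ℓ} {RB : Rel B 0ℓ} →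
                  Full RA → AF RB → AF (Pointwise RA RB)
af-sum-fullLeft {A} {B} {RA} fA aB = later λ
  { (inj₁ a) → AF-mono (af-leftMinimal aB) λ
      { {inj₁ y} _ → inj₂ (inj₁ (fA a y))
      ; {inj₂ _} {inj₂ _} r → inj₁ (inj₂ r) }
  ; (inj₂ b) → rightPart aB b }
  where
  rightPart : {S : Rel B 0ℓ} → AF S → ∀ b → AF (Pointwise RA S ↑ inj₂ b)
  rightPart (now fB) b = AF-mono (af-rightMinimal (now fA)) λ
    { {inj₂ y} _ → inj₂ (inj₂ (fB b y))
    ; {inj₁ _} {inj₁ _} r → inj₁ (inj₁ r) }
  rightPart (later hB) b = AF-mono (af-sum-fullLeft fA (hB b)) (pointwise-↑₂ b)

-- Disjoint sums of AF relations are AF (lexicographic induction on the two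
-- AF proofs, the full case being af-sum-fullLeft).
AF-sum : {A B : Set} {RA : Rel A 0ℓ} {RB : Rel B 0ℓ} → AF RA → AF RB → AF (Pointwise RA RB)
AF-sum (now fA) aB = af-sum-fullLeft fA aB
AF-sum {A} {B} {RA} aA@(later hA) aB = inner aB
  where
  inner : {S : Rel B 0ℓ} → AF S → AF (Pointwise RA S)
  inner (now fB) = AF-mono (AF-comap swap (af-sum-fullLeft fB aA)) pointwise-swap
  inner (later hB) = later λ
    { (inj₁ a) → AF-mono (AF-sum (hA a) (later hB)) (pointwise-↑₁ a)
    ; (inj₂ b) → AF-mono (inner (hB b)) (pointwise-↑₂ b) }

↑-decidable : {X : Set} {R : Rel X 0ℓ} → Decidable R → ∀ x → Decidable (R ↑ x)
↑-decidable R? x y z = R? y z ⊎-dec R? x y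

-- A decidable predicate P splits X into two parts; if Q is AF on each part,
-- it is AF on X (pull back the sum of the two restrictions).
AF-split : {X : Set} {Q : Rel X 0ℓ} (P : X → Set) → (∀ x → Dec (P x)) →
           AF (λ y z → ¬ P y → ¬ P z → Q y z) → AF (λ y z → P y → P z → Q y z) → AF Q
AF-split {X} {Q} P P? a¬P aP = AF-mono (AF-comap classify (AF-sum a¬P' aP')) conclude
  where
  classify : X → Σ X (¬_ ∘ P) ⊎ Σ X P
  classify x with P? x
  ... | yes p = inj₂ (x , p)
  ... | no ¬p = inj₁ (x , ¬p)
  a¬P' : AF (Q on proj₁ {B = ¬_ ∘ P})
  a¬P' = AF-mono (AF-comap proj₁ a¬P) λ {u} {v} q → q (proj₂ u) (proj₂ v)
  aP' : AF (Q on proj₁ {B = P})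
  aP' = AF-mono (AF-comap proj₁ aP) λ {u} {v} q → q (proj₂ u) (proj₂ v)
  conclude : (Pointwise _ _ on classify) ⇒ Q
  conclude {y} {z} r with P? y | P? z
  conclude (inj₁ q) | no _  | no _  = q
  conclude (inj₂ q) | yes _ | yes _ = q

-- After seeing x, split the later elements y by whether x R y: on those
-- not above x we continue with R ↑ x, on those above x with T ↑ x.
AF-∩ : {X : Set} {R T : Rel X 0ℓ} → Decidable R → AF R → AF T → AF (R ∩ T)
AF-∩ R? (now fR) aT = AF-mono aT λ {x} {y} t → fR x y , t
AF-∩ {X} {R} R? (later hR) aT = inner aT
  where
  inner : {T : Rel X 0ℓ} → AF T → AF (R ∩ T)
  inner (now fT) = AF-mono (later hR) λ {x} {y} r → r , fT x y
  inner (later hT) = later λ x → AF-split (R x) (R? x)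
    (AF-mono (AF-∩ (↑-decidable R? x) (hR x) (later hT)) λ
      { (inj₁ r , t) _ _ → inj₁ (r , t)
      ; (inj₂ r , t) ¬r _ → ⊥-elim (¬r r) })
    (AF-mono (inner (hT x)) λ
      { (r , inj₁ t) _ _ → inj₁ (r , t)
      ; (r , inj₂ t) rxy _ → inj₂ (rxy , t) })

Split : Set → Set
Split X = List X × X × List X

module _ {X : Set} {R : Rel X 0ℓ} where

  sublist-full : Full R → ∀ xs ys → length xs ℕ.≤ length ys → Sublist R xs ys
  sublist-full f []       ys       _         = minimum ys
  sublist-full f (x ∷ xs) (y ∷ ys) (s≤s le) = f x y ∷ sublist-full f xs ys le

  sublist-↑⁻ : ∀ {x u v} → Sublist (R ↑ x) u v → All (¬_ ∘ R x) u → Sublist R u v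
  sublist-↑⁻ []           []        = []
  sublist-↑⁻ (y ∷ʳ p)     ¬xu       = y ∷ʳ sublist-↑⁻ p ¬xu
  sublist-↑⁻ (inj₁ r ∷ p) (_ ∷ ¬xu) = r ∷ sublist-↑⁻ p ¬xu
  sublist-↑⁻ (inj₂ r ∷ p) (¬r ∷ _)  = ⊥-elim (¬r r)

  data FirstAbove (x : X) : List X → Set where
    none  : ∀ {u} → All (¬_ ∘ R x) u → FirstAbove x u
    first : ∀ u₁ y u₂ → All (¬_ ∘ R x) u₁ → R x y → FirstAbove x (u₁ ++ y ∷ u₂)

  firstAbove : Decidable R → ∀ x u → FirstAbove x u
  firstAbove R? x [] = none []
  firstAbove R? x (a ∷ u) with R? x a
  ... | yes r = first [] a u [] r
  ... | no ¬r with firstAbove R? x u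
  ...   | none ¬xu = none (¬r ∷ ¬xu)
  ...   | first u₁ y u₂ ¬xu₁ r = first (a ∷ u₁) y u₂ (¬r ∷ ¬xu₁) r

  shape : ∀ {x u} → FirstAbove x u → List X ⊎ Split X
  shape {u = u} (none _) = inj₁ u
  shape (first u₁ y u₂ _ _) = inj₂ (u₁ , y , u₂)

-- After a word x ∷ w has been seen, a list u is classified by its first
-- element above x; lists without one are handled by the induction hypothesis
-- for R ↑ x, split lists u₁ ++ y ∷ u₂ by the intersection of the hypotheses
-- for u₁ (R ↑ x), y (R) and u₂ (embedding ↑ w); a good pair of the second
-- kind either embeds, or contains x ∷ w.
higman : {X : Set} {R : Rel X 0ℓ} → Decidable R → AF R → AF (Sublist R)
higman R? (now f) = AF-mono (AF-comap length AF-≤) (sublist-full f _ _)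
higman {X} {R} R? (later h) = later step
  where
  step : ∀ w → AF (Sublist R ↑ w)
  step [] = now (λ u _ → inj₂ (minimum u))
  step (x ∷ w) = AF-mono (AF-comap (shape ∘ firstAbove R? x) (AF-sum afNone afFirst))
                         (λ {u} {v} → conclude (firstAbove R? x u) (firstAbove R? x v))
    where
    afNone : AF (Sublist (R ↑ x))
    afNone = higman (↑-decidable R? x) (h x)
    Prefix Pivot Suffix : Rel (Split X) 0ℓ
    Prefix = Sublist (R ↑ x) on proj₁
    Pivot  = R on (proj₁ ∘ proj₂)
    Suffix = (Sublist R ↑ w) on (proj₂ ∘ proj₂)
    afFirst : AF (Prefix ∩ (Pivot ∩ Suffix))
    afFirst = AF-∩ (λ a b → sublist? (↑-decidable R? x) (proj₁ a) (proj₁ b)) (AF-comap proj₁ afNone)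
              (AF-∩ (λ a b → R? (proj₁ (proj₂ a)) (proj₁ (proj₂ b))) (AF-comap (proj₁ ∘ proj₂) (later h))
                    (AF-comap (proj₂ ∘ proj₂) (step w)))
    conclude : ∀ {u v} (fu : FirstAbove x u) (fv : FirstAbove x v) →
               Pointwise (Sublist (R ↑ x)) (Prefix ∩ (Pivot ∩ Suffix)) (shape fu) (shape fv) →
               (Sublist R ↑ (x ∷ w)) u v
    conclude (none ¬xu) (none _) (inj₁ p) = inj₁ (sublist-↑⁻ p ¬xu)
    conclude (first u₁ _ _ ¬xu₁ _) (first _ _ _ _ _) (inj₂ (p₁ , r , inj₁ p₂)) =
      inj₁ (++⁺ (sublist-↑⁻ p₁ ¬xu₁) (r ∷ p₂))
    conclude (first u₁ _ _ _ rxy) (first _ _ _ _ _) (inj₂ (_ , _ , inj₂ p₂)) =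
      inj₂ (++⁺ (minimum u₁) (rxy ∷ p₂))

-- Congruence modulo 4: spiral directions and rotations only depend on it.
_≡₄_ : ℕ → ℕ → Set
m ≡₄ n = m % 4 ≡ n % 4

≡₄-+ʳ : ∀ m n d → m ≡₄ n → (m + d) ≡₄ (n + d)
≡₄-+ʳ m n d m≡n = begin
  (m + d) % 4               ≡⟨ %-distribˡ-+ m d 4 ⟩
  (m % 4 + d % 4) % 4       ≡⟨ cong (λ r → (r + d % 4) % 4) m≡n ⟩
  (n % 4 + d % 4) % 4       ≡⟨ %-distribˡ-+ n d 4 ⟨
  (n + d) % 4               ∎
  where open ≡-Reasoning

≤-∸-antisym : ∀ {a b} B → b ℕ.≤ B → a ℕ.≤ b → B ∸ a ℕ.≤ B ∸ b → a ≡ b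
≤-∸-antisym {a} {b} B b≤B a≤b le = begin
  a               ≡⟨ ℕP.m∸[m∸n]≡n (ℕP.≤-trans a≤b b≤B) ⟨
  B ∸ (B ∸ a)     ≡⟨ cong (B ∸_) (ℕP.≤-antisym le (ℕP.∸-monoʳ-≤ B a≤b)) ⟩
  B ∸ (B ∸ b)     ≡⟨ ℕP.m∸[m∸n]≡n b≤B ⟩
  b               ∎
  where open ≡-Reasoning

-- Congruence modulo 4 is AF (pigeonhole on the four residues, obtained as
-- the intersection of two AF orders on residues).
AF-≡₄ : AF _≡₄_
AF-≡₄ = AF-mono (AF-comap (_% 4) (AF-∩ ℕ._≤?_ AF-≤ (AF-comap (4 ∸_) AF-≤)))
                λ {_} {b} (le , le') → ≤-∸-antisym 4 (m%n≤n b 4) le le'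

-- An open quadrant around a point: (rightwards?, upwards?).
Quadrant : Set
Quadrant = Bool × Bool

Ordered : Bool → ℤ → ℤ → Set
Ordered true  u v = u ℤ.< v
Ordered false u v = v ℤ.< u

InQuadrant : Quadrant → Point → Point → Set
InQuadrant (h , v) p q = Ordered h (xc p) (xc q) × Ordered v (yc p) (yc q)

opposite : Quadrant → Quadrant
opposite (h , v) = not h , not v

ordered-flip : ∀ b {u v} → Ordered b u v → Ordered (not b) v u
ordered-flip true  u<v = u<v
ordered-flip false v<u = v<u

inQuadrant-flip : ∀ c {p q} → InQuadrant c p q → InQuadrant (opposite c) q p
inQuadrant-flip (h , v) (ox , oy) = ordered-flip h ox , ordered-flip v oy

SameOrder : Point → Point → Point → Point → Set
SameOrder p q p' q' = (xc p ℤ.< xc q ⇔ xc p' ℤ.< xc q') × (yc p ℤ.< yc q ⇔ yc p' ℤ.< yc q')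

ordered-⇔ : ∀ b {u v u' v'} → Ordered b u v → Ordered b u' v' → (u ℤ.< v ⇔ u' ℤ.< v')
ordered-⇔ true  u<v u'<v' = mk⇔ (λ _ → u'<v') (λ _ → u<v)
ordered-⇔ false v<u v'<u' =
  mk⇔ (λ u<v → ⊥-elim (ℤP.<-asym u<v v<u)) (λ u'<v' → ⊥-elim (ℤP.<-asym u'<v' v'<u'))

sameOrder : ∀ c {p q p' q'} → InQuadrant c p q → InQuadrant c p' q' → SameOrder p q p' q'
sameOrder (h , v) (ox , oy) (ox' , oy') = ordered-⇔ h ox ox' , ordered-⇔ v oy oy'

CommonQuadrant : Point → Point → Point → Point → Set
CommonQuadrant p q p' q' = Σ Quadrant λ c → InQuadrant c p q × InQuadrant c p' q'

commonQuadrant-flip : ∀ {p q p' q'} → CommonQuadrant p q p' q' → CommonQuadrant q p q' p'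
commonQuadrant-flip (c , i , i') = opposite c , inQuadrant-flip c i , inQuadrant-flip c i'

commonQuadrant⇒sameOrder : ∀ {p q p' q'} → CommonQuadrant p q p' q' → SameOrder p q p' q'
commonQuadrant⇒sameOrder (c , i , i') = sameOrder c i i'

sameOrder-refl : ∀ {p p'} → SameOrder p p p' p'
sameOrder-refl = mk⇔ irr irr , mk⇔ irr irr
  where
  irr : ∀ {A : Set} {u : ℤ} → u ℤ.< u → A
  irr u<u = ⊥-elim (ℤP.<-irrefl refl u<u)

-- The quadrant of q around p, given the quadrant after rotating both by 90°.
unrot : Quadrant → Quadrant
unrot (h , v) = v , not h

unrotN : ℕ → Quadrant → Quadrant
unrotN zero    c = c
unrotN (suc r) c = unrotN r (unrot c)

inQuadrant-rot : ∀ c {p q} → InQuadrant c (rot p) (rot q) → InQuadrant (unrot c) p q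
inQuadrant-rot (true  , v) (ox , oy) = oy , ℤP.neg-cancel-< ox
inQuadrant-rot (false , v) (ox , oy) = oy , ℤP.neg-cancel-< ox

inQuadrant-rotN : ∀ r c {p q} → InQuadrant c (rotN r p) (rotN r q) → InQuadrant (unrotN r c) p q
inQuadrant-rotN zero    c i = i
inQuadrant-rotN (suc r) c i = inQuadrant-rotN r (unrot c) (inQuadrant-rot c i)

unrotN-+ : ∀ m n c → unrotN (m + n) c ≡ unrotN n (unrotN m c)
unrotN-+ zero    n c = refl
unrotN-+ (suc m) n c = unrotN-+ m n (unrot c)

unrotN-*4 : ∀ q c → unrotN (q * 4) c ≡ c
unrotN-*4 zero    c       = refl
unrotN-*4 (suc q) (h , v) = trans (unrotN-*4 q _) (cong₂ _,_ (not-involutive h) (not-involutive v))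

unrotN-%4 : ∀ r c → unrotN r c ≡ unrotN (r % 4) c
unrotN-%4 r c = begin
  unrotN r c                            ≡⟨ cong (λ n → unrotN n c) (m≡m%n+[m/n]*n r 4) ⟩
  unrotN (r % 4 + r / 4 * 4) c          ≡⟨ unrotN-+ (r % 4) (r / 4 * 4) c ⟩
  unrotN (r / 4 * 4) (unrotN (r % 4) c) ≡⟨ unrotN-*4 (r / 4) _ ⟩
  unrotN (r % 4) c                      ∎
  where open ≡-Reasoning

turn : Dir → Dir
turn left  = down
turn down  = right
turn right = up
turn up    = left

reverse : Dir → Dir
reverse left  = right
reverse down  = up
reverse right = left
reverse up    = down

dirOf-suc : ∀ n → dirOf (suc n) ≡ turn (dirOf n)
dirOf-suc 0 = refl
dirOf-suc 1 = refl
dirOf-suc 2 = refl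
dirOf-suc 3 = refl
dirOf-suc (suc (suc (suc (suc n)))) = dirOf-suc n

dirOf-%4 : ∀ m n → m ≡₄ n → dirOf m ≡ dirOf n
dirOf-%4 m n eq with m % 4 | n % 4 | eq
... | _ | _ | refl = refl

Beyond : Dir → Point → Point → Set
Beyond left  p q = xc q ℤ.< xc p
Beyond right p q = xc p ℤ.< xc q
Beyond down  p q = yc q ℤ.< yc p
Beyond up    p q = yc p ℤ.< yc q

side-beyond : ∀ d {P n p} → SideOfHull d P n p → ∀ j → j ℕ.< n → Beyond d (P j) p
side-beyond left  s = s
side-beyond right s = s
side-beyond down  s = s
side-beyond up    s = s

-- The quadrant of a spiral point p_b around an earlier point pₐ, in terms
-- of the direction of p_b and whether a is its immediate predecessor.
spiralQuadrant : Dir → Bool → Quadrant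
spiralQuadrant right adjacent = true , adjacent
spiralQuadrant up    adjacent = not adjacent , true
spiralQuadrant left  adjacent = false , not adjacent
spiralQuadrant down  adjacent = adjacent , false

quadrant-past : ∀ d {p q} → Beyond (turn d) p q → Beyond d p q →
                InQuadrant (spiralQuadrant (turn d) false) p q
quadrant-past left  o₁ o₂ = o₂ , o₁
quadrant-past down  o₁ o₂ = o₁ , o₂
quadrant-past right o₁ o₂ = o₂ , o₁
quadrant-past up    o₁ o₂ = o₁ , o₂

quadrant-behind : ∀ d {p q} → Beyond (turn d) p q → Beyond (reverse d) p q →
                  InQuadrant (spiralQuadrant (turn d) true) p q
quadrant-behind left  o₁ o₂ = o₂ , o₁
quadrant-behind down  o₁ o₂ = o₁ , o₂
quadrant-behind right o₁ o₂ = o₂ , o₁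
quadrant-behind up    o₁ o₂ = o₁ , o₂

<-cycle : ∀ {a b c : ℤ} → a ℤ.< b → b ℤ.< c → c ℤ.< a → ⊥
<-cycle a<b b<c c<a = ℤP.<-irrefl refl (ℤP.<-trans (ℤP.<-trans a<b b<c) c<a)

record PinPosition (Q : ℕ → Point) (m : ℕ) (d : Dir) : Set where
  field
    outside : ∀ j → j ℕ.< suc m → Beyond (turn d) (Q j) (Q (suc m))
    past    : ∀ i → i ℕ.< m → Beyond d (Q i) (Q (suc m))
    behind  : Beyond (reverse d) (Q m) (Q (suc m))

-- A proper pin is forced into the first of the two 'between' alternatives:
-- the others contradict either its side or the direction of p_m seen from p₀.
pinPosition : ∀ {Q m} d → 0 ℕ.< m → ProperPin (turn d) Q (suc m) (Q (suc m)) →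
              Beyond d (Q 0) (Q m) → PinPosition Q m d
pinPosition up 0<m (side , inj₁ (inj₁ (below , b<m))) _ = record { outside = side ; past = below ; behind = b<m }
pinPosition up 0<m (side , inj₁ (inj₂ (above , m<b))) 0<m' = ⊥-elim (<-cycle (above 0 0<m) 0<m' m<b)
pinPosition up 0<m (side , inj₂ (inj₁ (rightOf , _))) _ = ⊥-elim (ℤP.<-asym (rightOf 0 0<m) (side 0 (s≤s z≤n)))
pinPosition {m = m} up 0<m (side , inj₂ (inj₂ (_ , m<b))) _ = ⊥-elim (ℤP.<-asym m<b (side m ℕP.≤-refl))
pinPosition left 0<m (side , inj₂ (inj₂ (leftOf , m<b))) _ = record { outside = side ; past = leftOf ; behind = m<b }
pinPosition left 0<m (side , inj₂ (inj₁ (rightOf , b<m))) m<0 = ⊥-elim (<-cycle (rightOf 0 0<m) b<m m<0)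
pinPosition left 0<m (side , inj₁ (inj₁ (below , _))) _ = ⊥-elim (ℤP.<-asym (below 0 0<m) (side 0 (s≤s z≤n)))
pinPosition {m = m} left 0<m (side , inj₁ (inj₂ (_ , m<b))) _ = ⊥-elim (ℤP.<-asym m<b (side m ℕP.≤-refl))
pinPosition down 0<m (side , inj₁ (inj₂ (above , m<b))) _ = record { outside = side ; past = above ; behind = m<b }
pinPosition down 0<m (side , inj₁ (inj₁ (below , b<m))) m<0 = ⊥-elim (<-cycle (below 0 0<m) b<m m<0)
pinPosition {m = m} down 0<m (side , inj₂ (inj₁ (_ , b<m))) _ = ⊥-elim (ℤP.<-asym b<m (side m ℕP.≤-refl))
pinPosition down 0<m (side , inj₂ (inj₂ (leftOf , _))) _ = ⊥-elim (ℤP.<-asym (leftOf 0 0<m) (side 0 (s≤s z≤n)))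
pinPosition right 0<m (side , inj₂ (inj₁ (rightOf , b<m))) _ = record { outside = side ; past = rightOf ; behind = b<m }
pinPosition right 0<m (side , inj₂ (inj₂ (leftOf , m<b))) 0<m' = ⊥-elim (<-cycle (leftOf 0 0<m) 0<m' m<b)
pinPosition {m = m} right 0<m (side , inj₁ (inj₁ (_ , b<m))) _ = ⊥-elim (ℤP.<-asym b<m (side m ℕP.≤-refl))
pinPosition right 0<m (side , inj₁ (inj₂ (above , _))) _ = ⊥-elim (ℤP.<-asym (above 0 0<m) (side 0 (s≤s z≤n)))

module StandardSpiral {k : ℕ} {Q : ℕ → Point} (spiral : StdSpiral k Q) where

  pin : ∀ n → 2 ℕ.≤ n → n ℕ.< k → ProperPin (dirOf n) Q n (Q n)
  pin = proj₂ (proj₂ (proj₂ (proj₂ spiral)))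

  beyond-first : ∀ j → 1 ℕ.≤ j → j ℕ.< k → Beyond (dirOf j) (Q 0) (Q j)
  beyond-first 1 _ _ = proj₁ (proj₂ (proj₂ (proj₂ spiral)))
  beyond-first (suc (suc m)) _ j<k =
    side-beyond (dirOf (suc (suc m))) (proj₁ (pin _ (s≤s (s≤s z≤n)) j<k)) 0 (s≤s z≤n)

  position : ∀ m → 0 ℕ.< m → suc m ℕ.< k → PinPosition Q m (dirOf m)
  position m 0<m b<k = pinPosition (dirOf m) 0<m
    (subst (λ d → ProperPin d Q (suc m) (Q (suc m))) (dirOf-suc m) (pin (suc m) (s≤s 0<m) b<k))
    (beyond-first m 0<m (ℕP.<-trans (ℕP.n<1+n m) b<k))

  quadrant-adjacent : ∀ m → suc m ℕ.< k → InQuadrant (spiralQuadrant (dirOf (suc m)) true) (Q m) (Q (suc m))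
  quadrant-adjacent zero _ = proj₁ (proj₂ (proj₂ spiral)) , proj₁ (proj₂ (proj₂ (proj₂ spiral)))
  quadrant-adjacent (suc m) b<k rewrite dirOf-suc (suc m) =
    quadrant-behind (dirOf (suc m)) (outside (suc m) ℕP.≤-refl) behind
    where open PinPosition (position (suc m) (s≤s z≤n) b<k)

  quadrant-far : ∀ a m → a ℕ.< m → suc m ℕ.< k →
                 InQuadrant (spiralQuadrant (dirOf (suc m)) false) (Q a) (Q (suc m))
  quadrant-far a m a<m b<k rewrite dirOf-suc m =
    quadrant-past (dirOf m) (outside a (ℕP.m<n⇒m<1+n a<m)) (past a a<m)
    where open PinPosition (position m (ℕP.≤-trans (s≤s z≤n) a<m) b<k)

  quadrant : ∀ a b → a ℕ.< b → b ℕ.< k → InQuadrant (spiralQuadrant (dirOf b) (does (suc a ≟ b))) (Q a) (Q b)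
  quadrant a b a<b b<k = decide b a<b b<k (suc a ≟ b)
    where
    decide : ∀ b → a ℕ.< b → b ℕ.< k → (adjacent? : Dec (suc a ≡ b)) →
             InQuadrant (spiralQuadrant (dirOf b) (does adjacent?)) (Q a) (Q b)
    decide _       _         b<k (yes refl) = quadrant-adjacent a b<k
    decide (suc m) (s≤s a≤m) b<k (no a+1≢b) =
      quadrant-far a m (ℕP.≤∧≢⇒< a≤m (λ a≡m → a+1≢b (cong suc a≡m))) b<k

spiralPosition : ℕ → ℕ → ℕ → Quadrant
spiralPosition r a b = unrotN r (spiralQuadrant (dirOf b) (does (suc a ≟ b)))

rotatedSpiral-quadrant : ∀ {k r} {P : ℕ → Point} → StdSpiral k (λ n → rotN r (P n)) →
                         ∀ {a b} → a ℕ.< b → b ℕ.< k → InQuadrant (spiralPosition r a b) (P a) (P b)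
rotatedSpiral-quadrant {r = r} spiral {a} {b} a<b b<k =
  inQuadrant-rotN r _ (StandardSpiral.quadrant spiral a b a<b b<k)

spiralPosition-cong : ∀ r a b r' a' b' → r ≡₄ r' → b ≡₄ b' → (suc a ≡ b ⇔ suc a' ≡ b') →
                      spiralPosition r a b ≡ spiralPosition r' a' b'
spiralPosition-cong r a b r' a' b' r≡r' b≡b' adj = begin
  unrotN r c          ≡⟨ unrotN-%4 r c ⟩
  unrotN (r % 4) c    ≡⟨ cong₂ unrotN r≡r' (cong₂ spiralQuadrant (dirOf-%4 b b' b≡b') same-adjacency) ⟩
  unrotN (r' % 4) c'  ≡⟨ unrotN-%4 r' c' ⟨
  unrotN r' c'        ∎
  where
  open ≡-Reasoning
  c  = spiralQuadrant (dirOf b) (does (suc a ≟ b))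
  c' = spiralQuadrant (dirOf b') (does (suc a' ≟ b'))
  same-adjacency : does (suc a ≟ b) ≡ does (suc a' ≟ b')
  same-adjacency = does-⇔ adj (suc a ≟ b) (suc a' ≟ b')

-- A run (s , l) is the interval of indices s, s + 1, …, s + l.
Run : Set
Run = ℕ × ℕ

InRun : Run → ℕ → Set
InRun (s , l) t = s ℕ.≤ t × t ℕ.≤ s + l

InRuns : List Run → ℕ → Set
InRuns D t = Any (λ ρ → InRun ρ t) D

-- A list of runs in decreasing order with gaps: every index of a later run
-- is at least two below the start of an earlier one, so runs are maximal.
Separated : List Run → Set
Separated []            = ⊤
Separated ((s , _) ∷ D) = (∀ {t} → InRuns D t → suc (suc t) ℕ.≤ s) × Separated D

RunLE : Rel Run 0ℓ
RunLE = (_≡₄_ on proj₁) ∩ (ℕ._≤_ on proj₂)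

-- A map of index sets preserving order, residues mod 4 and adjacency: what
-- is needed to transport relative positions from one spiral to another.
record IndexEmbedding (A A' : ℕ → Set) : Set where
  field
    map        : ℕ → ℕ
    into       : ∀ {t} → A t → A' (map t)
    residue    : ∀ {t} → A t → map t ≡₄ t
    increasing : ∀ {a b} → A a → A b → a ℕ.< b → map a ℕ.< map b
    adjacency  : ∀ {a b} → A a → A b → a ℕ.< b → (suc a ≡ b ⇔ suc (map a) ≡ map b)

shift : ℕ → ℕ → ℕ → ℕ
shift s s' t = s' + (t ∸ s)

shift-< : ∀ {s a b} s' → s ℕ.≤ a → a ℕ.< b → shift s s' a ℕ.< shift s s' b
shift-< s' s≤a a<b = ℕP.+-monoʳ-< s' (ℕP.∸-monoˡ-< a<b s≤a)

shift-suc : ∀ {s a} s' → s ℕ.≤ a → suc (shift s s' a) ≡ shift s s' (suc a)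
shift-suc {s} {a} s' s≤a = begin
  suc (s' + (a ∸ s))   ≡⟨ ℕP.+-suc s' (a ∸ s) ⟨
  s' + suc (a ∸ s)     ≡⟨ cong (s' +_) (ℕP.+-∸-assoc 1 s≤a) ⟨
  s' + (suc a ∸ s)     ∎
  where open ≡-Reasoning

shift-injective : ∀ {s a b} s' → s ℕ.≤ a → s ℕ.≤ b → shift s s' a ≡ shift s s' b → a ≡ b
shift-injective {s} {a} {b} s' s≤a s≤b eq = begin
  a             ≡⟨ ℕP.m+[n∸m]≡n s≤a ⟨
  s + (a ∸ s)   ≡⟨ cong (s +_) (ℕP.+-cancelˡ-≡ s' _ _ eq) ⟩
  s + (b ∸ s)   ≡⟨ ℕP.m+[n∸m]≡n s≤b ⟩
  b             ∎
  where open ≡-Reasoning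

shift-adjacency : ∀ {s a b} s' → s ℕ.≤ a → s ℕ.≤ b → (suc a ≡ b ⇔ suc (shift s s' a) ≡ shift s s' b)
shift-adjacency {s} {a} s' s≤a s≤b = mk⇔
  (λ a+1≡b → trans (shift-suc s' s≤a) (cong (shift s s') a+1≡b))
  (λ eq → shift-injective s' (ℕP.m≤n⇒m≤1+n s≤a) s≤b (trans (sym (shift-suc s' s≤a)) eq))

shift-residue : ∀ s s' t → s' ≡₄ s → s ℕ.≤ t → shift s s' t ≡₄ t
shift-residue s s' t s'≡s s≤t = trans (≡₄-+ʳ s' s (t ∸ s) s'≡s) (cong (_% 4) (ℕP.m+[n∸m]≡n s≤t))

runMap : ∀ {D D'} → Sublist RunLE D D' → ℕ → ℕ
runMap []                                 t = t
runMap (_ ∷ʳ p)                           t = runMap p t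
runMap (_∷_ {x = s , _} {y = s' , _} _ p) t with s ≤? t
... | yes _ = shift s s' t
... | no _  = runMap p t

gap⇒≰ : ∀ {t s} → suc (suc t) ℕ.≤ s → ¬ s ℕ.≤ t
gap⇒≰ gap = ℕP.<⇒≱ (ℕP.<-trans (ℕP.n<1+n _) gap)

gapped : ∀ {a b a' b'} → suc (suc a) ℕ.≤ b → suc (suc a') ℕ.≤ b' →
         a' ℕ.< b' × (suc a ≡ b ⇔ suc a' ≡ b')
gapped gap gap' = ℕP.≤-trans (ℕP.n≤1+n _) gap' , mk⇔ (λ e → ⊥-elim (ℕP.<-irrefl e gap))
                                                       (λ e → ⊥-elim (ℕP.<-irrefl e gap'))

runMap-into : ∀ {D D'} (p : Sublist RunLE D D') → Separated D → ∀ {t} → InRuns D t → InRuns D' (runMap p t)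
runMap-into (_ ∷ʳ p) sep i = there (runMap-into p sep i)
runMap-into (_∷_ {x = s , l} {y = s' , l'} (_ , l≤l') p) (gap , sep) {t} i with s ≤? t | i
... | yes s≤t | here (_ , t≤s+l) =
  here (ℕP.m≤m+n s' _ , ℕP.+-monoʳ-≤ s' (ℕP.≤-trans (ℕP.m≤n+o⇒m∸n≤o t s t≤s+l) l≤l'))
... | yes s≤t | there i'       = ⊥-elim (gap⇒≰ (gap i') s≤t)
... | no s≰t  | here (s≤t , _) = ⊥-elim (s≰t s≤t)
... | no _    | there i'       = there (runMap-into p sep i')

runMap-residue : ∀ {D D'} (p : Sublist RunLE D D') → ∀ {t} → InRuns D t → runMap p t ≡₄ t
runMap-residue (_ ∷ʳ p) i = runMap-residue p i
runMap-residue (_∷_ {x = s , _} {y = s' , _} (s≡s' , _) p) {t} i with s ≤? t | i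
... | yes s≤t | _              = shift-residue s s' t (sym s≡s') s≤t
... | no s≰t  | here (s≤t , _) = ⊥-elim (s≰t s≤t)
... | no _    | there i'       = runMap-residue p i'

runMap-order : ∀ {D D'} (p : Sublist RunLE D D') → Separated D → Separated D' →
               ∀ {a b} → InRuns D a → InRuns D b → a ℕ.< b →
               runMap p a ℕ.< runMap p b × (suc a ≡ b ⇔ suc (runMap p a) ≡ runMap p b)
runMap-order (_ ∷ʳ p) sep (_ , sep') ia ib a<b = runMap-order p sep sep' ia ib a<b
runMap-order (_∷_ {x = s , _} {y = s' , _} _ p) (gap , sep) (gap' , sep') {a} {b} ia ib a<b
  with s ≤? a | s ≤? b | ia | ib
... | yes s≤a | yes s≤b | _ | _ = shift-< s' s≤a a<b , shift-adjacency s' s≤a s≤b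
... | yes s≤a | no s≰b  | _ | _ = ⊥-elim (s≰b (ℕP.≤-trans s≤a (ℕP.<⇒≤ a<b)))
... | no s≰a  | _       | here (s≤a , _) | _ = ⊥-elim (s≰a s≤a)
... | no _    | yes s≤b | there ia' | _ =
  gapped (ℕP.≤-trans (gap ia') s≤b) (ℕP.≤-trans (gap' (runMap-into p sep ia')) (ℕP.m≤m+n s' _))
... | no _    | no s≰b  | _ | here (s≤b , _) = ⊥-elim (s≰b s≤b)
... | no _    | no _    | there ia' | there ib' = runMap-order p sep sep' ia' ib' a<b

runEmbedding : ∀ {D D'} → Sublist RunLE D D' → Separated D → Separated D' → IndexEmbedding (InRuns D) (InRuns D')
runEmbedding p sep sep' = record
  { map        = runMap p
  ; into       = runMap-into p sep
  ; residue    = runMap-residue p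
  ; increasing = λ ia ib a<b → proj₁ (runMap-order p sep sep' ia ib a<b)
  ; adjacency  = λ ia ib a<b → proj₂ (runMap-order p sep sep' ia ib a<b)
  }

record IsRunDecomposition (A : ℕ → Set) (k : ℕ) (D : List Run) : Set where
  field
    separated : Separated D
    sound     : ∀ {t} → InRuns D t → A t × t ℕ.< k
    complete  : ∀ {t} → A t → t ℕ.< k → InRuns D t

RunDecomposition : (ℕ → Set) → ℕ → Set
RunDecomposition A k = Σ (List Run) (IsRunDecomposition A k)

below-head : ∀ {s l D t} → Separated ((s , l) ∷ D) → InRuns ((s , l) ∷ D) t → t ℕ.≤ s + l
below-head _         (here (_ , t≤s+l)) = t≤s+l
below-head (gap , _) (there i)          =
  ℕP.≤-trans (ℕP.<⇒≤ (ℕP.<-trans (ℕP.n<1+n _) (gap i))) (ℕP.m≤m+n _ _)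

module Decomposition {A : ℕ → Set} (A? : ∀ t → Dec (A t)) where

  skipIndex : ∀ {k D} → IsRunDecomposition A k D → ¬ A k → IsRunDecomposition A (suc k) D
  skipIndex {k} {D} dec ¬Ak = record
    { separated = separated
    ; sound = λ i → proj₁ (sound i) , ℕP.m<n⇒m<1+n (proj₂ (sound i))
    ; complete = complete′ }
    where
    open IsRunDecomposition dec
    complete′ : ∀ {t} → A t → t ℕ.< suc k → InRuns D t
    complete′ At t<k+1 with ℕP.m<1+n⇒m<n∨m≡n t<k+1
    ... | inj₁ t<k  = complete At t<k
    ... | inj₂ refl = ⊥-elim (¬Ak At)

  newRun : ∀ {k D} → A k → IsRunDecomposition A k D →
           (∀ {t} → InRuns D t → suc (suc t) ℕ.≤ k) → RunDecomposition A (suc k)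
  newRun {k} {D} Ak dec gap = (k , 0) ∷ D , record
    { separated = gap , separated ; sound = sound′ ; complete = complete′ }
    where
    open IsRunDecomposition dec
    sound′ : ∀ {t} → InRuns ((k , 0) ∷ D) t → A t × t ℕ.< suc k
    sound′ (here (k≤t , t≤k+0)) with ℕP.≤-antisym k≤t (subst (_ ℕ.≤_) (ℕP.+-identityʳ k) t≤k+0)
    ... | refl = Ak , ℕP.n<1+n k
    sound′ (there i) = proj₁ (sound i) , ℕP.m<n⇒m<1+n (proj₂ (sound i))
    complete′ : ∀ {t} → A t → t ℕ.< suc k → InRuns ((k , 0) ∷ D) t
    complete′ At t<k+1 with ℕP.m<1+n⇒m<n∨m≡n t<k+1
    ... | inj₁ t<k  = there (complete At t<k)
    ... | inj₂ refl = here (ℕP.≤-refl , ℕP.m≤m+n _ 0)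

  fresh : ∀ {k s l D} → IsRunDecomposition A k ((s , l) ∷ D) → suc (s + l) ≢ k →
          ∀ {t} → InRuns ((s , l) ∷ D) t → suc (suc t) ℕ.≤ k
  fresh {k} {s} {l} dec top≢k i =
    ℕP.≤-trans (s≤s (s≤s (below-head separated i))) (ℕP.≤∧≢⇒< top<k top≢k)
    where
    open IsRunDecomposition dec
    top<k : s + l ℕ.< k
    top<k = proj₂ (sound (here (ℕP.m≤m+n s l , ℕP.≤-refl)))

  extendRun : ∀ {k s l D} → A k → suc (s + l) ≡ k → IsRunDecomposition A k ((s , l) ∷ D) →
              RunDecomposition A (suc k)
  extendRun {k} {s} {l} {D} Ak refl dec = (s , suc l) ∷ D , record
    { separated = separated ; sound = sound′ ; complete = complete′ }
    where
    open IsRunDecomposition dec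
    top : s + suc l ≡ k
    top = ℕP.+-suc s l
    sound′ : ∀ {t} → InRuns ((s , suc l) ∷ D) t → A t × t ℕ.< suc k
    sound′ {t} (here (s≤t , t≤top)) with ℕP.m≤n⇒m<n∨m≡n t≤top
    ... | inj₁ t<top = let (At , t<k) = sound (here (s≤t , ℕP.≤-pred (subst (suc t ℕ.≤_) top t<top)))
                       in At , ℕP.m<n⇒m<1+n t<k
    ... | inj₂ t≡top rewrite trans t≡top top = Ak , ℕP.n<1+n k
    sound′ (there i) = proj₁ (sound (there i)) , ℕP.m<n⇒m<1+n (proj₂ (sound (there i)))
    complete′ : ∀ {t} → A t → t ℕ.< suc k → InRuns ((s , suc l) ∷ D) t
    complete′ At t<k+1 with ℕP.m<1+n⇒m<n∨m≡n t<k+1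
    ... | inj₂ refl = here (ℕP.≤-trans (ℕP.m≤m+n s l) (ℕP.n≤1+n _) , ℕP.≤-reflexive (sym top))
    ... | inj₁ t<k with complete At t<k
    ...   | here (s≤t , t≤s+l) = here (s≤t , ℕP.≤-trans t≤s+l (ℕP.+-monoʳ-≤ s (ℕP.n≤1+n l)))
    ...   | there i            = there i

  decompose : ∀ k → RunDecomposition A k
  decompose zero = [] , record { separated = tt ; sound = λ () ; complete = λ _ () }
  decompose (suc k) with decompose k | A? k
  ... | D , dec | no ¬Ak = D , skipIndex dec ¬Ak
  ... | [] , dec | yes Ak = newRun Ak dec (λ ())
  ... | (s , l) ∷ D , dec | yes Ak with suc (s + l) ≟ k
  ...   | yes top≡k = extendRun Ak top≡k dec
  ...   | no top≢k  = newRun Ak dec (fresh dec top≢k)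

≼-from-sameOrder : ∀ {σ σ' k k' P P'} (c : ContainedIn σ k P) (c' : ContainedIn σ' k' P')
                   (E : Fin (len σ) → Fin (len σ')) →
                   (∀ i j → SameOrder (P (proj₁ c i)) (P (proj₁ c j))
                                      (P' (proj₁ c' (E i))) (P' (proj₁ c' (E j)))) →
                   σ ≼ σ'
≼-from-sameOrder {σ} {σ'} (e , _ , x⇔ , y⇔) (e' , _ , x⇔' , y⇔') E same = E , increasing , values
  where
  increasing : ∀ i j → i Fin.< j → E i Fin.< E j
  increasing i j i<j = from (x⇔' (E i) (E j)) (to (proj₁ (same i j)) (to (x⇔ i j) i<j))
  values : ∀ i j → (fun σ i Fin.< fun σ j) ⇔ (fun σ' (E i) Fin.< fun σ' (E j))
  values i j = ⇔-sym (y⇔' (E i) (E j)) ⇔-∘ (proj₂ (same i j) ⇔-∘ y⇔ i j)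

module Transfer {k k' r r' : ℕ} {P P' : ℕ → Point}
                (spiral : StdSpiral k (λ n → rotN r (P n))) (spiral' : StdSpiral k' (λ n → rotN r' (P' n)))
                (r≡r' : r ≡₄ r') {A A' : ℕ → Set} (bound : ∀ {t} → A t → t ℕ.< k)
                (bound' : ∀ {t} → A' t → t ℕ.< k') (emb : IndexEmbedding A A') where
  open IndexEmbedding emb

  -- An increasing pair and its image lie in the quadrant given by the spiral
  -- lemma, since rotations, residues and adjacency agree.
  commonQuadrant-< : ∀ {a b} → A a → A b → a ℕ.< b → CommonQuadrant (P a) (P b) (P' (map a)) (P' (map b))
  commonQuadrant-< {a} {b} Aa Ab a<b =
    spiralPosition r a b ,
    rotatedSpiral-quadrant {r = r} {P} spiral a<b (bound Ab) ,
    subst (λ c → InQuadrant c (P' (map a)) (P' (map b))) same-position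
      (rotatedSpiral-quadrant {r = r'} {P'} spiral' (increasing Aa Ab a<b) (bound' (into Ab)))
    where
    same-position : spiralPosition r' (map a) (map b) ≡ spiralPosition r a b
    same-position = spiralPosition-cong r' (map a) (map b) r a b (sym r≡r') (residue Ab) (⇔-sym (adjacency Aa Ab a<b))

  sameOrder-transfer : ∀ {a b} → A a → A b → SameOrder (P a) (P b) (P' (map a)) (P' (map b))
  sameOrder-transfer {a} {b} Aa Ab with ℕP.<-cmp a b
  ... | tri< a<b _ _ = commonQuadrant⇒sameOrder (commonQuadrant-< Aa Ab a<b)
  ... | tri> _ _ b<a = commonQuadrant⇒sameOrder (commonQuadrant-flip (commonQuadrant-< Ab Aa b<a))
  ... | tri≈ _ refl _ = sameOrder-refl

-- A permutation of 𝒲 is encoded by the rotation of its spiral and the runs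
-- of the indices it occupies.
Code : Set
Code = ℕ × List Run

CodeLE : Rel Code 0ℓ
CodeLE = (_≡₄_ on proj₁) ∩ (Sublist RunLE on proj₂)

AF-RunLE : AF RunLE
AF-RunLE = AF-∩ (λ ρ ρ' → proj₁ ρ % 4 ≟ proj₁ ρ' % 4) (AF-comap proj₁ AF-≡₄) (AF-comap proj₂ AF-≤)

RunLE? : Decidable RunLE
RunLE? ρ ρ' = (proj₁ ρ % 4 ≟ proj₁ ρ' % 4) ×-dec (proj₂ ρ ℕ.≤? proj₂ ρ')

AF-Code : AF CodeLE
AF-Code = AF-∩ (λ c c' → proj₁ c % 4 ≟ proj₁ c' % 4) (AF-comap proj₁ AF-≡₄)
               (AF-comap proj₂ (higman RunLE? AF-RunLE))

module Member (σ : Perm) (w : InW σ) where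

  k : ℕ
  k = proj₁ w

  P : ℕ → Point
  P = proj₁ (proj₂ w)

  r : ℕ
  r = proj₁ (proj₁ (proj₂ (proj₂ w)))

  spiral : StdSpiral k (λ n → rotN r (P n))
  spiral = proj₂ (proj₁ (proj₂ (proj₂ w)))

  contained : ContainedIn σ k P
  contained = proj₂ (proj₂ (proj₂ w))

  e : Fin (len σ) → ℕ
  e = proj₁ contained

  Used : ℕ → Set
  Used t = ∃ λ i → e i ≡ t

  decomposition : RunDecomposition Used k
  decomposition = Decomposition.decompose (λ t → any? (λ i → e i ≟ t)) k

  runs : List Run
  runs = proj₁ decomposition

  open IsRunDecomposition (proj₂ decomposition) public

  used-in-runs : ∀ i → InRuns runs (e i)
  used-in-runs i = complete (i , refl) (proj₁ (proj₂ contained) i)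

  code : Code
  code = r , runs

-- Comparable codes give containment: the run embedding sends every index
-- occupied by σ to one occupied by σ', and positions are transported.
code-≼ : ∀ {σ σ'} (w : InW σ) (w' : InW σ') → CodeLE (Member.code σ w) (Member.code σ' w') → σ ≼ σ'
code-≼ {σ} {σ'} w w' (r≡r' , runs⊑runs') =
  ≼-from-sameOrder {σ} {σ'} {M.k} {M'.k} {M.P} {M'.P} M.contained M'.contained E same
  where
  module M = Member σ w
  module M' = Member σ' w'
  emb : IndexEmbedding (InRuns M.runs) (InRuns M'.runs)
  emb = runEmbedding runs⊑runs' M.separated M'.separated
  open IndexEmbedding emb using (map; into)
  image : ∀ i → M'.Used (map (M.e i))
  image i = proj₁ (M'.sound (into (M.used-in-runs i)))
  E : Fin (len σ) → Fin (len σ')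
  E i = proj₁ (image i)
  same : ∀ i j → SameOrder (M.P (M.e i)) (M.P (M.e j)) (M'.P (M'.e (E i))) (M'.P (M'.e (E j)))
  same i j = subst₂ (λ u v → SameOrder (M.P (M.e i)) (M.P (M.e j)) (M'.P u) (M'.P v))
    (sym (proj₂ (image i))) (sym (proj₂ (image j)))
    (Transfer.sameOrder-transfer {M.k} {M'.k} {M.r} {M'.r} {M.P} {M'.P} M.spiral M'.spiral r≡r'
      (proj₂ ∘ M.sound) (proj₂ ∘ M'.sound) emb
      (M.used-in-runs i) (M.used-in-runs j))

-- 𝒲 has no infinite antichain: its codes would form a bad sequence.
proposition6 : ¬ InfiniteAntichainInW
proposition6 (s , inW , antichain) = noGoodPair (AF-good AF-Code (λ n → Member.code (s n) (inW n)))
  where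
  noGoodPair : ¬ (Σ ℕ λ i → Σ ℕ λ j → i ℕ.< j ×
                  CodeLE (Member.code (s i) (inW i)) (Member.code (s j) (inW j)))
  noGoodPair (i , j , i<j , i⊑j) = antichain i j (ℕP.<⇒≢ i<j) (code-≼ {s i} {s j} (inW i) (inW j) i⊑j)
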